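{- Let $G$ be a finite simple graph and let $M=\{e_1,\dots,e_k\}$ be an induced matching in $G$, where $e_i=u_iv_i$ for $i=1,\dots,k$. Let $\mathcal{D}'$ be a path decomposition of $G'=G\setminus M$. Suppose that for each $i=1,\dots,k$, the vertex $u_i$ has no passing neighbor in $\mathcal{D}'$ (i.e. there is no $w\in N_{G'}(u_i)$ with $\mathcal{D}'(w)=0$) and $\mathcal{D}'(v_i)\ge 1$. Then there is a path decomposition $\mathcal{D}$ of $G$ such that $|\mathcal{D}|=|\mathcal{D}'|$; for $i=1,\dots,k$, $\mathcal{D}(u_i)=\mathcal{D}'(u_i)+1$ and $\mathcal{D}(v_i)=\mathcal{D}'(v_i)-1$; and $\mathcal{D}(w)=\mathcal{D}'(w)$ for every $w\in V(G)\setminus V(M)$.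
   Context: A path decomposition of a graph $H$ is a collection of edge-disjoint paths of $H$ covering $E(H)$. For a path decomposition $\mathcal{D}$ and a vertex $u$, $\mathcal{D}(u)$ denotes the number of paths in $\mathcal{D}$ having $u$ as an end vertex. A set of edges $M$ is an induced matching in $G$ if the subgraph of $G$ induced by the vertices incident to edges of $M$ has edge set exactly $M$. $G\setminus M$ denotes the graph $(V(G),E(G)\setminus M)$, and $V(M)$ the set of vertices incident to edges of $M$. -}

module Defs where

open import Data.Nat using (ℕ; zero; suc; _+_; _≤_)
open import Data.Bool using (Bool; true; false; _∧_; _∨_; not; if_then_else_)
open import Data.Fin using (Fin; _≟_)
open import Data.List using (List; []; _∷_; length; map; reverse; allFin)
open import Data.Nat.ListAction using (sum)
open import Data.Bool.ListAction using (any)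
open import Data.List.Relation.Unary.Linked using (Linked)
open import Data.List.Relation.Unary.Unique.Propositional using (Unique)
open import Data.Product using (_×_; Σ)
open import Data.Sum using (_⊎_)
open import Data.List.Membership.Propositional using (_∈_)
open import Relation.Nullary using (¬_)
open import Relation.Nullary.Decidable using (⌊_⌋)
open import Relation.Binary.PropositionalEquality using (_≡_)

record Graph (n : ℕ) : Set where
  field
    adj    : Fin n → Fin n → Bool
    sym    : ∀ x y → adj x y ≡ adj y x
    irrefl : ∀ x → adj x x ≡ false
open Graph public

EdgeRel : ℕ → Set
EdgeRel n = Fin n → Fin n → Bool

sameEdge : ∀ {n} → Fin n → Fin n → Fin n → Fin n → Bool
sameEdge a b x y = (⌊ a ≟ x ⌋ ∧ ⌊ b ≟ y ⌋) ∨ (⌊ a ≟ y ⌋ ∧ ⌊ b ≟ x ⌋)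

-- {x,y} ∈ M where M = {u i v i | i : Fin k}
inM : ∀ {n k} → (Fin k → Fin n) → (Fin k → Fin n) → Fin n → Fin n → Bool
inM {k = k} u v x y = any (λ i → sameEdge (u i) (v i) x y) (allFin k)

delete : ∀ {n k} → Graph n → (Fin k → Fin n) → (Fin k → Fin n) → EdgeRel n
delete G u v x y = adj G x y ∧ not (inM u v x y)

InVM : ∀ {n k} → (Fin k → Fin n) → (Fin k → Fin n) → Fin n → Set
InVM {k = k} u v x = Σ (Fin k) (λ i → (x ≡ u i) ⊎ (x ≡ v i))

record IsInducedMatching {n k} (G : Graph n) (u v : Fin k → Fin n) : Set where
  field
    edges   : ∀ i → adj G (u i) (v i) ≡ true
    u-inj   : ∀ i j → u i ≡ u j → i ≡ j
    v-inj   : ∀ i j → v i ≡ v j → i ≡ j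
    u≢v     : ∀ i j → ¬ (u i ≡ v j)
    induced : ∀ x y → InVM u v x → InVM u v y → adj G x y ≡ true →
              inM u v x y ≡ true

record IsPath {n} (E : EdgeRel n) (p : List (Fin n)) : Set where
  field
    nontrivial : 2 ≤ length p
    distinct   : Unique p
    walk       : Linked (λ a b → E a b ≡ true) p

occ : ∀ {n} → Fin n → Fin n → List (Fin n) → ℕ
occ x y []           = 0
occ x y (a ∷ [])     = 0
occ x y (a ∷ b ∷ ps) = (if sameEdge a b x y then 1 else 0) + occ x y (b ∷ ps)

-- A path decomposition: a collection (list) of paths of H that are pairwise
-- edge-disjoint and cover E(H), i.e. every edge of H lies in exactly one of them.
record IsPathDecomposition {n} (E : EdgeRel n) (D : List (List (Fin n))) : Set where
  field
    paths : ∀ p → p ∈ D → IsPath E p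
    exact : ∀ x y → E x y ≡ true → sum (map (occ x y) D) ≡ 1

startsAt : ∀ {n} → Fin n → List (Fin n) → Bool
startsAt w []      = false
startsAt w (a ∷ _) = ⌊ w ≟ a ⌋

isEnd : ∀ {n} → Fin n → List (Fin n) → Bool
isEnd w p = startsAt w p ∨ startsAt w (reverse p)

endCount : ∀ {n} → List (List (Fin n)) → Fin n → ℕ
endCount D w = sum (map (λ p → if isEnd w p then 1 else 0) D)

module Submission where

-- The matching edges are inserted one at a time, so everything rests on a
-- single-edge insertion lemma ('AddEdge'): if uv is a non-edge of a graph E,
-- D₀ is a path decomposition of E, v is an end of some path of D₀ and every
-- E-neighbour of u is an end of some path of D₀, then E + uv has a path
-- decomposition D with |D| = |D₀| and D(w) + [w = v] = D₀(w) + [w = u].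
--
-- Its proof is a rerouting process.  At every stage we hold a collection that
-- decomposes E + uz except for the single edge uz, where z is a "floating
-- end" (initially z = v).  Take a path R ending at z.  If u ∉ R, appending u to
-- R finishes.  Otherwise R = C u b A z; replace R by C u z A⁻¹ b, which covers
-- uz but drops ub, so b becomes the new floating end.  The floating ends
-- visited form a trail of distinct vertices (each of them is the end of the
-- "arm" of a path leaving u through the next one), so the process stops.

open import Defs hiding (sym)
open import Data.Nat using (ℕ; zero; suc; _+_; _≤_; _<_; _≥_; _∸_; z≤n; s≤s)
open import Data.Nat.Properties hiding (_≟_)
open import Data.Bool using (Bool; true; false; _∧_; _∨_; not; if_then_else_)
open import Data.Bool.ListAction using (any)
open import Data.Bool.Properties
  using (∧-comm; ∨-comm; ∨-assoc; ∨-identityʳ; ∨-zeroʳ; ∧-identityʳ; ∧-zeroʳ; ¬-not; not-injective)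
open import Data.Empty using (⊥-elim)
open import Function using (case_of_)
open import Data.Fin using (Fin; _≟_)
open import Data.List using (List; []; _∷_; _++_; [_]; length; map; reverse; allFin)
open import Data.List.Membership.Propositional using (_∈_; _∉_)
open import Data.List.Membership.Propositional.Properties
  using (∈-++⁺ˡ; ∈-++⁺ʳ; ∈-∃++; ∈-allFin; ∈-insert)
open import Data.List.Properties
  using (∷-injective; ++-assoc; reverse-++; unfold-reverse; reverse-involutive; length-++; length-reverse)
open import Data.List.Relation.Unary.All using (All)
open import Data.List.Relation.Unary.All.Properties using (¬Any⇒All¬)
open import Data.List.Relation.Unary.AllPairs using (AllPairs)
open import Data.List.Relation.Unary.Any using (here; there)
open import Data.List.Relation.Unary.Linked using (Linked; []; [-]; _∷_)
open import Data.List.Relation.Unary.Unique.Propositional using (Unique)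
open import Data.List.Relation.Unary.Unique.Propositional.Properties using (Unique[x∷xs]⇒x∉xs; allFin⁺)
open import Data.Nat.ListAction using (sum)
open import Data.Nat.Solver using (module +-*-Solver)
open import Data.Product using (Σ; _×_; _,_; proj₁; proj₂)
open import Data.Sum using (_⊎_; inj₁; inj₂; [_,_]′)
open import Relation.Binary.PropositionalEquality hiding ([_])
open import Relation.Nullary using (¬_; yes; no)
open import Relation.Nullary.Decidable using (⌊_⌋)
import Data.List.Relation.Binary.Permutation.Propositional as Perm
import Data.List.Relation.Binary.Permutation.Propositional.Properties as PermP
import Data.List.Relation.Binary.Permutation.Setoid.Properties as PermS
import Data.List.Relation.Unary.Linked as Linked
open +-*-Solver using (solve; _:+_; _:=_)
open Perm using (_↭_; ↭⇒↭ₛ; prep; ↭-sym)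

ι : Bool → ℕ
ι b = if b then 1 else 0

δ : ∀ {n} → Fin n → Fin n → ℕ
δ a w = ι ⌊ w ≟ a ⌋

≟-refl : ∀ {n} (a : Fin n) → ⌊ a ≟ a ⌋ ≡ true
≟-refl a with a ≟ a
... | yes _ = refl
... | no a≢a = ⊥-elim (a≢a refl)

≟-false : ∀ {n} {a b : Fin n} → a ≢ b → ⌊ a ≟ b ⌋ ≡ false
≟-false {a = a} {b} a≢b with a ≟ b
... | yes a≡b = ⊥-elim (a≢b a≡b)
... | no _ = refl

≟-true : ∀ {n} {a b : Fin n} → ⌊ a ≟ b ⌋ ≡ true → a ≡ b
≟-true {a = a} {b} e with a ≟ b
... | yes a≡b = a≡b
≟-true () | no _

δ-self : ∀ {n} (a : Fin n) → δ a a ≡ 1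
δ-self a rewrite ≟-refl a = refl

δ-ne : ∀ {n} {a w : Fin n} → w ≢ a → δ a w ≡ 0
δ-ne w≢a rewrite ≟-false w≢a = refl

∧-true : ∀ {p q} → p ∧ q ≡ true → p ≡ true × q ≡ true
∧-true {true} {true} _ = refl , refl

∨-true : ∀ {p q} → p ∨ q ≡ true → p ≡ true ⊎ q ≡ true
∨-true {true} _ = inj₁ refl
∨-true {false} {true} _ = inj₂ refl

ι-∨ : ∀ a b → ¬ (a ≡ true × b ≡ true) → ι (a ∨ b) ≡ ι a + ι b
ι-∨ true true excl = ⊥-elim (excl (refl , refl))
ι-∨ true false _ = refl
ι-∨ false b _ = refl

sameEdge-swap : ∀ {n} (a b x y : Fin n) → sameEdge a b x y ≡ sameEdge b a x y
sameEdge-swap a b x y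
  rewrite ∧-comm ⌊ a ≟ x ⌋ ⌊ b ≟ y ⌋ | ∧-comm ⌊ a ≟ y ⌋ ⌊ b ≟ x ⌋ =
  ∨-comm (⌊ b ≟ y ⌋ ∧ ⌊ a ≟ x ⌋) (⌊ b ≟ x ⌋ ∧ ⌊ a ≟ y ⌋)

sameEdge-swap′ : ∀ {n} (a b x y : Fin n) → sameEdge a b x y ≡ sameEdge a b y x
sameEdge-swap′ a b x y = ∨-comm (⌊ a ≟ x ⌋ ∧ ⌊ b ≟ y ⌋) (⌊ a ≟ y ⌋ ∧ ⌊ b ≟ x ⌋)

sameEdge-refl : ∀ {n} (x y : Fin n) → sameEdge x y x y ≡ true
sameEdge-refl x y rewrite ≟-refl x | ≟-refl y = refl

sameEdge-true : ∀ {n} {a b x y : Fin n} → sameEdge a b x y ≡ true →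
                (a ≡ x × b ≡ y) ⊎ (a ≡ y × b ≡ x)
sameEdge-true {a = a} {b} {x} {y} e with ∨-true {⌊ a ≟ x ⌋ ∧ ⌊ b ≟ y ⌋} e
... | inj₁ e₁ = let (p , q) = ∧-true e₁ in inj₁ (≟-true p , ≟-true q)
... | inj₂ e₂ = let (p , q) = ∧-true {⌊ a ≟ y ⌋} e₂ in inj₂ (≟-true p , ≟-true q)

sameEdge-loop : ∀ {n} {a b : Fin n} → a ≢ b → ∀ x → sameEdge a b x x ≡ false
sameEdge-loop {a = a} {b} a≢b x = ¬-not λ e → [ loop , loop ]′ (sameEdge-true {a = a} {b} {x} {x} e)
  where
  loop : ¬ (a ≡ x × b ≡ x)
  loop (p , q) = a≢b (trans p (sym q))

swap₃ : ∀ a b c → (a + b) + c ≡ (a + c) + b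
swap₃ = solve 3 (λ a b c → (a :+ b) :+ c := (a :+ c) :+ b) refl

rotate₃ : ∀ a b c → (a + b) + c ≡ b + (a + c)
rotate₃ = solve 3 (λ a b c → (a :+ b) :+ c := b :+ (a :+ c)) refl

swapInner : ∀ K p q O → (K + (p + O)) + q ≡ (K + (q + O)) + p
swapInner = solve 4 (λ K p q O → (K :+ (p :+ O)) :+ q := (K :+ (q :+ O)) :+ p) refl

combine : ∀ a b c d p q → a + p ≡ b + d → a + q ≡ c + d → b + q ≡ c + p
combine a b c d p q h₁ h₂ = +-cancelʳ-≡ d (b + q) (c + p) (begin
    b + q + d   ≡⟨ swap₃ b q d ⟩
    b + d + q   ≡⟨ cong (_+ q) (sym h₁) ⟩
    a + p + q   ≡⟨ swap₃ a p q ⟩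
    a + q + p   ≡⟨ cong (_+ p) h₂ ⟩
    c + d + p   ≡⟨ swap₃ c d p ⟩
    c + p + d   ∎)
  where open ≡-Reasoning

balance-00 : ∀ {a b} → a + 0 ≡ b + 0 → a ≡ b
balance-00 {a} {b} e = trans (sym (+-identityʳ a)) (trans e (+-identityʳ b))

balance-01 : ∀ {a b} → a + 0 ≡ b + 1 → a ≡ suc b
balance-01 {a} {b} e = trans (sym (+-identityʳ a)) (trans e (+-comm b 1))

balance-10 : ∀ {a b} → a + 1 ≡ b + 0 → a ≡ b ∸ 1
balance-10 {a} {b} e = trans (sym (m+n∸n≡m a 1)) (cong (_∸ 1) (trans e (+-identityʳ b)))

chain : ∀ a b c p q s t → a + p ≡ b + q → b + s ≡ c + t → a + (p + s) ≡ c + (q + t)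
chain a b c p q s t h₁ h₂ = begin
    a + (p + s)   ≡⟨ sym (+-assoc a p s) ⟩
    a + p + s     ≡⟨ cong (_+ s) h₁ ⟩
    b + q + s     ≡⟨ swap₃ b q s ⟩
    b + s + q     ≡⟨ cong (_+ q) h₂ ⟩
    c + t + q     ≡⟨ +-assoc c t q ⟩
    c + (t + q)   ≡⟨ cong (c +_) (+-comm t q) ⟩
    c + (q + t)   ∎
  where open ≡-Reasoning

lastOr : ∀ {A : Set} → A → List A → A
lastOr d [] = d
lastOr d (x ∷ xs) = lastOr x xs

module _ {A : Set} where

  lastOr-snoc : ∀ (d : A) X c → lastOr d (X ++ [ c ]) ≡ c
  lastOr-snoc d [] c = refl
  lastOr-snoc d (x ∷ X) c = lastOr-snoc x X c

  lastOr-∈ : ∀ (d : A) X → lastOr d X ∈ (d ∷ X)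
  lastOr-∈ d [] = here refl
  lastOr-∈ d (x ∷ X) = there (lastOr-∈ x X)

  snoc-last : ∀ (d : A) {W W′ : List A} {a a′} → W ++ [ a ] ≡ W′ ++ [ a′ ] → a ≡ a′
  snoc-last d {W} {W′} {a} {a′} e =
    trans (sym (lastOr-snoc d W a)) (trans (cong (lastOr d) e) (lastOr-snoc d W′ a′))

  reverse-cons : ∀ (h : A) T → Σ (List A) λ T′ → reverse (h ∷ T) ≡ lastOr h T ∷ T′
  reverse-cons h [] = [] , refl
  reverse-cons h (t ∷ T) with reverse-cons t T
  ... | T″ , e = T″ ++ [ h ] , trans (unfold-reverse h (t ∷ T)) (cong (_++ [ h ]) e)

  reverse-snoc : ∀ (X : List A) z → reverse (X ++ [ z ]) ≡ z ∷ reverse X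
  reverse-snoc X z = reverse-++ X [ z ]

  reverse-mid : ∀ (X : List A) u T → reverse (X ++ u ∷ T) ≡ reverse T ++ u ∷ reverse X
  reverse-mid X u T = begin
      reverse (X ++ u ∷ T)            ≡⟨ reverse-++ X (u ∷ T) ⟩
      reverse (u ∷ T) ++ reverse X    ≡⟨ cong (_++ reverse X) (unfold-reverse u T) ⟩
      (reverse T ++ [ u ]) ++ reverse X ≡⟨ ++-assoc (reverse T) [ u ] (reverse X) ⟩
      reverse T ++ u ∷ reverse X      ∎
    where open ≡-Reasoning

  snoc-view : ∀ (A₀ : List A) z → Σ A λ b → Σ (List A) λ A₁ → A₀ ++ [ z ] ≡ b ∷ A₁
  snoc-view [] z = z , [] , refl
  snoc-view (a ∷ A₀) z = a , A₀ ++ [ z ] , refl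

  suffix-snoc : ∀ (C : List A) u A′ X z → C ++ u ∷ A′ ≡ X ++ [ z ] → u ≢ z →
                Σ (List A) λ A₀ → A′ ≡ A₀ ++ [ z ]
  suffix-snoc [] u A′ [] z refl u≢z = ⊥-elim (u≢z refl)
  suffix-snoc [] u A′ (x ∷ X) z e _ = X , proj₂ (∷-injective e)
  suffix-snoc (c ∷ []) u A′ [] z () _
  suffix-snoc (c ∷ c′ ∷ C) u A′ [] z () _
  suffix-snoc (c ∷ C) u A′ (x ∷ X) z e u≢z = suffix-snoc C u A′ X z (proj₂ (∷-injective e)) u≢z

  length≥2 : ∀ (C : List A) x y T → 2 ≤ length (C ++ x ∷ y ∷ T)
  length≥2 [] x y T = s≤s (s≤s z≤n)
  length≥2 (c ∷ C) x y T = m≤n⇒m≤1+n (length≥2 C x y T)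

  unique-↭ : ∀ {xs ys : List A} → xs ↭ ys → Unique xs → Unique ys
  unique-↭ p = PermS.Unique-resp-↭ (setoid A) (↭⇒↭ₛ p)

  unique-mid : ∀ {u : A} X T → Unique (X ++ u ∷ T) → u ∉ X × u ∉ T
  unique-mid {u} X T un =
    let u∉ = Unique[x∷xs]⇒x∉xs (unique-↭ (PermP.shift u X T) un)
    in (λ m → u∉ (∈-++⁺ˡ m)) , (λ m → u∉ (∈-++⁺ʳ X m))

  unique-after : ∀ {u c : A} X Y → Unique (X ++ u ∷ c ∷ Y) → c ∉ X
  unique-after {u} {c} X Y un m =
    proj₁ (unique-mid (X ++ [ u ]) Y (subst Unique (sym (++-assoc X [ u ] (c ∷ Y))) un)) (∈-++⁺ˡ m)

  unique-snoc : ∀ {u : A} X → u ∉ X → Unique X → Unique (X ++ [ u ])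
  unique-snoc {u} X u∉X un =
    unique-↭ (↭-sym (PermP.++-comm X [ u ])) (AllPairs._∷_ (¬Any⇒All¬ X u∉X) un)

  unique-reverse : ∀ {X : List A} → Unique X → Unique (reverse X)
  unique-reverse {X} = unique-↭ (↭-sym (PermP.↭-reverse X))

  unique-flip : ∀ (C : List A) u B → Unique (C ++ u ∷ B) → Unique (C ++ u ∷ reverse B)
  unique-flip C u B = unique-↭ (PermP.++⁺ˡ C (prep u (↭-sym (PermP.↭-reverse B))))

  split-unique : ∀ {u : A} X T X′ T′ → X ++ u ∷ T ≡ X′ ++ u ∷ T′ → u ∉ X → u ∉ X′ →
                 X ≡ X′ × T ≡ T′
  split-unique [] T [] T′ refl _ _ = refl , refl
  split-unique [] T (x′ ∷ X′) T′ refl _ u∉X′ = ⊥-elim (u∉X′ (here refl))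
  split-unique (x ∷ X) T [] T′ refl u∉X _ = ⊥-elim (u∉X (here refl))
  split-unique (x ∷ X) T (x′ ∷ X′) T′ e u∉X u∉X′ with ∷-injective e
  ... | refl , e′ with split-unique X T X′ T′ e′ (λ m → u∉X (there m)) (λ m → u∉X′ (there m))
  ... | refl , refl = refl , refl

  module _ {R : A → A → Set} where

    linked-join : ∀ X a Y → Linked R (X ++ [ a ]) → Linked R (a ∷ Y) → Linked R (X ++ a ∷ Y)
    linked-join [] a Y _ l = l
    linked-join (x ∷ []) a Y (r ∷ _) l = r ∷ l
    linked-join (x ∷ x′ ∷ X) a Y (r ∷ l₁) l = r ∷ linked-join (x′ ∷ X) a Y l₁ l

    linked-split : ∀ X a Y → Linked R (X ++ a ∷ Y) → Linked R (X ++ [ a ]) × Linked R (a ∷ Y)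
    linked-split [] a Y l = [-] , l
    linked-split (x ∷ []) a Y (r ∷ l) = (r ∷ [-]) , l
    linked-split (x ∷ x′ ∷ X) a Y (r ∷ l) =
      let (l₁ , l₂) = linked-split (x′ ∷ X) a Y l in (r ∷ l₁) , l₂

    linked-reverse : (∀ {a b} → R a b → R b a) → ∀ X → Linked R X → Linked R (reverse X)
    linked-reverse R-sym [] l = l
    linked-reverse R-sym (x ∷ []) l = l
    linked-reverse R-sym (x ∷ y ∷ X) (r ∷ l) =
      subst (Linked R) e
        (linked-join (reverse X) y [ x ]
          (subst (Linked R) (unfold-reverse y X) (linked-reverse R-sym (y ∷ X) l)) (R-sym r ∷ [-]))
      where
      e : reverse X ++ y ∷ [ x ] ≡ reverse (x ∷ y ∷ X)
      e = trans (sym (++-assoc (reverse X) [ y ] [ x ]))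
            (trans (cong (_++ [ x ]) (sym (unfold-reverse y X))) (sym (unfold-reverse x (y ∷ X))))

    linked-pred : ∀ y S {b} → Linked R (y ∷ S) → b ∈ S → Σ A λ p → p ∈ (y ∷ S) × R p b
    linked-pred y (s ∷ S) (r ∷ l) (here refl) = y , here refl , r
    linked-pred y (s ∷ S) (r ∷ l) (there m) with linked-pred s S l m
    ... | p , p∈ , rp = p , there p∈ , rp

    linked-weaken : ∀ {R′ : A → A → Set} {P : A → Set} a xs → Linked R (a ∷ xs) → All P xs →
                    (∀ {a c} → P c → R a c → R′ a c) → Linked R′ (a ∷ xs)
    linked-weaken a [] l ps f = [-]
    linked-weaken a (c ∷ xs) (r ∷ l) (All._∷_ pc ps) f = f pc r ∷ linked-weaken c xs l ps f

module _ {n : ℕ} (x y : Fin n) where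

  occ-split : ∀ (A : List (Fin n)) c B → occ x y (A ++ c ∷ B) ≡ occ x y (A ++ [ c ]) + occ x y (c ∷ B)
  occ-split [] c B = refl
  occ-split (a ∷ []) c B = sym (cong (_+ occ x y (c ∷ B)) (+-identityʳ (ι (sameEdge a c x y))))
  occ-split (a ∷ a′ ∷ A) c B rewrite occ-split (a′ ∷ A) c B =
    sym (+-assoc (ι (sameEdge a a′ x y)) (occ x y ((a′ ∷ A) ++ [ c ])) (occ x y (c ∷ B)))

  occ-reverse : ∀ (A : List (Fin n)) → occ x y (reverse A) ≡ occ x y A
  occ-reverse [] = refl
  occ-reverse (a ∷ []) = refl
  occ-reverse (a ∷ a′ ∷ A) = begin
      occ x y (reverse (a ∷ a′ ∷ A))
    ≡⟨ cong (occ x y) (reverse-mid [] a (a′ ∷ A)) ⟩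
      occ x y (reverse (a′ ∷ A) ++ [ a ])
    ≡⟨ cong (λ t → occ x y (t ++ [ a ])) (unfold-reverse a′ A) ⟩
      occ x y ((reverse A ++ [ a′ ]) ++ [ a ])
    ≡⟨ cong (occ x y) (++-assoc (reverse A) [ a′ ] [ a ]) ⟩
      occ x y (reverse A ++ a′ ∷ [ a ])
    ≡⟨ occ-split (reverse A) a′ [ a ] ⟩
      occ x y (reverse A ++ [ a′ ]) + (ι (sameEdge a′ a x y) + 0)
    ≡⟨ cong₂ _+_ (trans (cong (occ x y) (sym (unfold-reverse a′ A))) (occ-reverse (a′ ∷ A)))
                 (trans (+-identityʳ _) (cong ι (sameEdge-swap a′ a x y))) ⟩
      occ x y (a′ ∷ A) + ι (sameEdge a a′ x y)
    ≡⟨ +-comm (occ x y (a′ ∷ A)) _ ⟩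
      occ x y (a ∷ a′ ∷ A) ∎
    where open ≡-Reasoning

occ-step : ∀ {n} (u c : Fin n) X Y → 1 ≤ occ u c (X ++ u ∷ c ∷ Y)
occ-step u c X Y rewrite occ-split u c X u (c ∷ Y) | sameEdge-refl u c =
  ≤-trans (s≤s z≤n) (m≤n+m (suc (occ u c (c ∷ Y))) (occ u c (X ++ [ u ])))

occ-nonedge : ∀ {n} (E : EdgeRel n) → (∀ x y → E x y ≡ E y x) →
              ∀ {p} → Linked (λ a b → E a b ≡ true) p → ∀ x y → E x y ≡ false → occ x y p ≡ 0
occ-nonedge E E-sym [] x y _ = refl
occ-nonedge E E-sym [-] x y _ = refl
occ-nonedge E E-sym {a ∷ b ∷ ps} (r ∷ l) x y nonedge with sameEdge a b x y in es
... | false = occ-nonedge E E-sym l x y nonedge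
... | true with sameEdge-true {a = a} {b} {x} {y} es
... | inj₁ (refl , refl) = ⊥-elim (true≢false (trans (sym r) nonedge))
  where true≢false : true ≢ false
        true≢false ()
... | inj₂ (refl , refl) = ⊥-elim (true≢false (trans (sym r) (trans (E-sym a b) nonedge)))
  where true≢false : true ≢ false
        true≢false ()

sum-zero : ∀ {B : Set} (f : B → ℕ) (L : List B) → (∀ p → p ∈ L → f p ≡ 0) → sum (map f L) ≡ 0
sum-zero f [] h = refl
sum-zero f (p ∷ L) h rewrite h p (here refl) = sum-zero f L (λ q m → h q (there m))

module _ {B : Set} (f : B → ℕ) where

  private
    Σf : List B → ℕ
    Σf L = sum (map f L)

  replace-sum : ∀ L₁ x y L₂ k k′ → f x + k ≡ f y + k′ →
                Σf (L₁ ++ x ∷ L₂) + k ≡ Σf (L₁ ++ y ∷ L₂) + k′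
  replace-sum [] x y L₂ k k′ e = begin
      (f x + Σf L₂) + k   ≡⟨ rotate₃ (f x) (Σf L₂) k ⟩
      Σf L₂ + (f x + k)   ≡⟨ cong (Σf L₂ +_) e ⟩
      Σf L₂ + (f y + k′)  ≡⟨ sym (rotate₃ (f y) (Σf L₂) k′) ⟩
      (f y + Σf L₂) + k′  ∎
    where open ≡-Reasoning
  replace-sum (l ∷ L₁) x y L₂ k k′ e = begin
      (f l + Σf (L₁ ++ x ∷ L₂)) + k   ≡⟨ +-assoc (f l) _ k ⟩
      f l + (Σf (L₁ ++ x ∷ L₂) + k)   ≡⟨ cong (f l +_) (replace-sum L₁ x y L₂ k k′ e) ⟩
      f l + (Σf (L₁ ++ y ∷ L₂) + k′)  ≡⟨ sym (+-assoc (f l) _ k′) ⟩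
      (f l + Σf (L₁ ++ y ∷ L₂)) + k′  ∎
    where open ≡-Reasoning

  member-≤ : ∀ {x L} → x ∈ L → f x ≤ Σf L
  member-≤ {x} {.x ∷ L} (here refl) = m≤m+n (f x) (Σf L)
  member-≤ {x} {l ∷ L} (there m) = ≤-trans (member-≤ m) (m≤n+m (Σf L) (f l))

  unique-positive : ∀ {x y L} → x ∈ L → y ∈ L → 1 ≤ f x → 1 ≤ f y → Σf L ≤ 1 → x ≡ y
  unique-positive (here refl) (here refl) _ _ _ = refl
  unique-positive {L = l ∷ L} (here refl) (there m) px py s =
    ⊥-elim (1+n≰n (≤-trans (+-mono-≤ px (≤-trans py (member-≤ m))) s))
  unique-positive {L = l ∷ L} (there m) (here refl) px py s =
    ⊥-elim (1+n≰n (≤-trans (+-mono-≤ py (≤-trans px (member-≤ m))) s))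
  unique-positive {L = l ∷ L} (there m) (there m′) px py s =
    unique-positive m m′ px py (≤-trans (m≤n+m (Σf L) (f l)) s)

module _ {B : Set} where

  length-replace : ∀ (L₁ : List B) x y L₂ → length (L₁ ++ x ∷ L₂) ≡ length (L₁ ++ y ∷ L₂)
  length-replace [] x y L₂ = refl
  length-replace (l ∷ L₁) x y L₂ = cong suc (length-replace L₁ x y L₂)

  member-replace : ∀ (L₁ : List B) x y L₂ {m} → m ∈ (L₁ ++ y ∷ L₂) → m ∈ (L₁ ++ x ∷ L₂) ⊎ m ≡ y
  member-replace [] x y L₂ (here e) = inj₂ e
  member-replace [] x y L₂ (there m) = inj₁ (there m)
  member-replace (l ∷ L₁) x y L₂ (here e) = inj₁ (here e)
  member-replace (l ∷ L₁) x y L₂ (there m) with member-replace L₁ x y L₂ m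
  ... | inj₁ m′ = inj₁ (there m′)
  ... | inj₂ e = inj₂ e

sum-mono : ∀ {B : Set} (g h : B → ℕ) xs → (∀ w → g w ≤ h w) → sum (map g xs) ≤ sum (map h xs)
sum-mono g h [] le = z≤n
sum-mono g h (x ∷ xs) le = +-mono-≤ (le x) (sum-mono g h xs le)

sum-strict : ∀ {B : Set} (g h : B → ℕ) {b} xs → (∀ w → g w ≤ h w) → b ∈ xs → g b < h b →
             sum (map g xs) < sum (map h xs)
sum-strict g h (x ∷ xs) le (here refl) lt = +-mono-<-≤ lt (sum-mono g h xs le)
sum-strict g h (x ∷ xs) le (there m) lt = +-mono-≤-< (le x) (sum-strict g h xs le m lt)

count-injective : ∀ {k n} (f : Fin k → Fin n) {i} L → Unique L → i ∈ L → (∀ j → f j ≡ f i → j ≡ i) →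
                  sum (map (λ j → δ (f j) (f i)) L) ≡ 1
count-injective f {i} (j ∷ L) un@(AllPairs._∷_ _ _) (here refl) inj =
  cong₂ _+_ (δ-self (f i))
    (sum-zero _ L λ j′ m → δ-ne λ e → Unique[x∷xs]⇒x∉xs un (subst (_∈ L) (inj j′ (sym e)) m))
count-injective f {i} (j ∷ L) un@(AllPairs._∷_ _ un′) (there m) inj =
  cong₂ _+_ (δ-ne λ e → Unique[x∷xs]⇒x∉xs un (subst (_∈ L) (sym (inj j (sym e))) m))
    (count-injective f L un′ m inj)

module _ {A : Set} (f : A → Bool) where

  any-false : ∀ L → (∀ j → j ∈ L → f j ≡ false) → any f L ≡ false
  any-false [] h = refl
  any-false (x ∷ L) h rewrite h x (here refl) = any-false L (λ j m → h j (there m))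

  any-true : ∀ {x} L → x ∈ L → f x ≡ true → any f L ≡ true
  any-true (y ∷ L) (here refl) e rewrite e = refl
  any-true (y ∷ L) (there m) e rewrite any-true L m e = ∨-zeroʳ (f y)

  any-witness : ∀ L → any f L ≡ true → Σ A λ j → j ∈ L × f j ≡ true
  any-witness (x ∷ L) e with f x in fx
  ... | true = x , here refl , fx
  ... | false with any-witness L e
  ... | j , m , fj = j , there m , fj

any-cong : ∀ {A : Set} (f g : A → Bool) L → (∀ j → f j ≡ g j) → any f L ≡ any g L
any-cong f g [] h = refl
any-cong f g (x ∷ L) h rewrite h x | any-cong f g L h = refl

module _ {n : ℕ} where

  Oriented : List (Fin n) → List (Fin n) → Set
  Oriented R M = (R ≡ M) ⊎ (R ≡ reverse M)

  Oriented-sym : ∀ {R M} → Oriented R M → Oriented M R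
  Oriented-sym (inj₁ refl) = inj₁ refl
  Oriented-sym (inj₂ refl) = inj₂ (sym (reverse-involutive _))

  Oriented-join : ∀ {R₁ R₂ M} → Oriented R₁ M → Oriented R₂ M → Oriented R₁ R₂
  Oriented-join (inj₁ refl) (inj₁ refl) = inj₁ refl
  Oriented-join {M = M} (inj₁ refl) (inj₂ refl) = inj₂ (sym (reverse-involutive M))
  Oriented-join (inj₂ refl) (inj₁ refl) = inj₂ refl
  Oriented-join (inj₂ refl) (inj₂ refl) = inj₁ refl

  occ-oriented : ∀ {R M} x y → Oriented R M → occ x y R ≡ occ x y M
  occ-oriented x y (inj₁ refl) = refl
  occ-oriented {M = M} x y (inj₂ refl) = occ-reverse x y M

  Traverses : List (List (Fin n)) → List (Fin n) → Set
  Traverses D R = Σ (List (Fin n)) λ M → M ∈ D × Oriented R M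

  startsAt-rev-snoc : ∀ (w : Fin n) X z → startsAt w (reverse (X ++ [ z ])) ≡ ⌊ w ≟ z ⌋
  startsAt-rev-snoc w X z rewrite reverse-snoc X z = refl

  startsAt-mid : ∀ (w : Fin n) C u X Y → startsAt w (C ++ u ∷ X) ≡ startsAt w (C ++ u ∷ Y)
  startsAt-mid w [] u X Y = refl
  startsAt-mid w (c ∷ C) u X Y = refl

  startsAt-view : ∀ {z : Fin n} L → startsAt z L ≡ true → Σ (List (Fin n)) λ T → L ≡ z ∷ T
  startsAt-view (h ∷ T) e = T , cong (_∷ T) (sym (≟-true e))

  isEnd-reverse : ∀ (w : Fin n) p → isEnd w (reverse p) ≡ isEnd w p
  isEnd-reverse w p rewrite reverse-involutive p = ∨-comm (startsAt w (reverse p)) (startsAt w p)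

  isEnd-oriented : ∀ {R M} w → Oriented R M → isEnd w R ≡ isEnd w M
  isEnd-oriented w (inj₁ refl) = refl
  isEnd-oriented {M = M} w (inj₂ refl) = isEnd-reverse w M

  -- The two ends of a repetition-free sequence with ≥ 2 vertices are distinct,
  -- so the end indicator is the sum of the first- and last-vertex indicators.
  isEnd-split : ∀ (w : Fin n) p → Unique p → 2 ≤ length p →
                ι (isEnd w p) ≡ ι (startsAt w p) + ι (startsAt w (reverse p))
  isEnd-split w (h ∷ []) un (s≤s ())
  isEnd-split w (h ∷ t ∷ T) un _ with reverse-cons h (t ∷ T)
  ... | T′ , e rewrite e = ι-∨ ⌊ w ≟ h ⌋ ⌊ w ≟ lastOr t T ⌋ λ (p , q) →
    Unique[x∷xs]⇒x∉xs un (subst (_∈ (t ∷ T)) (trans (sym (≟-true q)) (≟-true p)) (lastOr-∈ t T))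

  orient-to : ∀ z R₀ → isEnd z R₀ ≡ true →
              Σ (List (Fin n)) λ R → Oriented R₀ R × Σ (List (Fin n)) λ X → R ≡ X ++ [ z ]
  orient-to z R₀ end with startsAt z (reverse R₀) in e
  ... | true with startsAt-view (reverse R₀) e
  ...   | T , eT = R₀ , inj₁ refl , reverse T ,
          trans (sym (reverse-involutive R₀)) (trans (cong reverse eT) (unfold-reverse z T))
  orient-to z R₀ end | false with startsAt-view R₀ (trans (sym (∨-identityʳ _)) end)
  ...   | T , eT = reverse R₀ , inj₂ (sym (reverse-involutive R₀)) , reverse T ,
          trans (cong reverse eT) (unfold-reverse z T)

module _ {n : ℕ} {E : EdgeRel n} where

  IsPath-reverse : (∀ {a b} → E a b ≡ true → E b a ≡ true) → ∀ {p} → IsPath E p → IsPath E (reverse p)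
  IsPath-reverse E-sym {p} ip = record
    { nontrivial = subst (2 ≤_) (sym (length-reverse p)) (IsPath.nontrivial ip)
    ; distinct = unique-reverse (IsPath.distinct ip)
    ; walk = linked-reverse E-sym p (IsPath.walk ip) }

  IsPath-oriented : (∀ {a b} → E a b ≡ true → E b a ≡ true) → ∀ {R M} → IsPath E M → Oriented R M → IsPath E R
  IsPath-oriented E-sym ip (inj₁ refl) = ip
  IsPath-oriented E-sym ip (inj₂ refl) = IsPath-reverse E-sym ip

decomposition-resp : ∀ {n} {E₁ E₂ : EdgeRel n} {D} → (∀ x y → E₁ x y ≡ E₂ x y) →
                     IsPathDecomposition E₁ D → IsPathDecomposition E₂ D
decomposition-resp {E₁ = E₁} {E₂} eq dec = record
  { paths = λ p m → let ip = IsPathDecomposition.paths dec p m in record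
      { nontrivial = IsPath.nontrivial ip ; distinct = IsPath.distinct ip
      ; walk = Linked.map (λ {x} {y} e → trans (sym (eq x y)) e) (IsPath.walk ip) }
  ; exact = λ x y h → IsPathDecomposition.exact dec x y (trans (eq x y) h) }

-- The termination measure of the rerouting: the number of vertices outside a list.
memberB : ∀ {n} → Fin n → List (Fin n) → Bool
memberB w [] = false
memberB w (s ∷ S) = ⌊ w ≟ s ⌋ ∨ memberB w S

outside : ∀ {n} → List (Fin n) → ℕ
outside {n} S = sum (map (λ w → ι (not (memberB w S))) (allFin n))

outside-cons : ∀ {n} (b : Fin n) S → b ∉ S → outside (b ∷ S) < outside S
outside-cons {n} b S b∉S =
  sum-strict _ _ (allFin n) (λ w → pointwise ⌊ w ≟ b ⌋ (memberB w S)) (∈-allFin b) at-b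
  where
  pointwise : ∀ a m → ι (not (a ∨ m)) ≤ ι (not m)
  pointwise true true = z≤n
  pointwise true false = z≤n
  pointwise false true = z≤n
  pointwise false false = s≤s z≤n
  memberB-∉ : ∀ S → b ∉ S → memberB b S ≡ false
  memberB-∉ [] _ = refl
  memberB-∉ (s ∷ S) b∉ rewrite ≟-false {a = b} {s} (λ e → b∉ (here e)) = memberB-∉ S (λ m → b∉ (there m))
  at-b : ι (not (⌊ b ≟ b ⌋ ∨ memberB b S)) < ι (not (memberB b S))
  at-b rewrite ≟-refl b | memberB-∉ S b∉S = s≤s z≤n

mult : ∀ {n} → List (List (Fin n)) → Fin n → Fin n → ℕ
mult D x y = sum (map (occ x y) D)

find-end-path : ∀ {n} (z a c : Fin n) D → mult D a c < endCount D z →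
                Σ (List (List (Fin n))) λ L₁ → Σ (List (Fin n)) λ R₀ → Σ (List (List (Fin n))) λ L₂ →
                (D ≡ L₁ ++ R₀ ∷ L₂) × (isEnd z R₀ ≡ true) × (occ a c R₀ ≡ 0)
find-end-path z a c (p ∷ D) lt with isEnd z p in end | occ a c p in avoids
... | true | zero = [] , p , D , refl , end , avoids
... | true | suc k =
  let (L₁ , R₀ , L₂ , eq , r₁ , r₂) = find-end-path z a c D (≤-trans (s≤s (m≤n+m (mult D a c) k)) (≤-pred lt))
  in p ∷ L₁ , R₀ , L₂ , cong (p ∷_) eq , r₁ , r₂
... | false | k =
  let (L₁ , R₀ , L₂ , eq , r₁ , r₂) = find-end-path z a c D (≤-trans (s≤s (m≤n+m (mult D a c) k)) lt)
  in p ∷ L₁ , R₀ , L₂ , cong (p ∷_) eq , r₁ , r₂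

isEnd-snoc : ∀ {n} (w : Fin n) X z → Unique (X ++ [ z ]) → 2 ≤ length (X ++ [ z ]) →
             ι (isEnd w (X ++ [ z ])) ≡ ι (startsAt w (X ++ [ z ])) + δ z w
isEnd-snoc w X z un len =
  trans (isEnd-split w (X ++ [ z ]) un len) (cong (λ t → ι (startsAt w (X ++ [ z ])) + ι t) (startsAt-rev-snoc w X z))

module AddEdge {n : ℕ} (E : EdgeRel n) (E-sym : ∀ x y → E x y ≡ E y x) (E-irrefl : ∀ x → E x x ≡ false)
  (u v : Fin n) (u≢v : u ≢ v) (uv∉E : E u v ≡ false)
  (D₀ : List (List (Fin n))) (dec₀ : IsPathDecomposition E D₀)
  (v-end : 1 ≤ endCount D₀ v) (u-nbrs-end : ∀ w → E u w ≡ true → 1 ≤ endCount D₀ w) where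

  E⁺ : EdgeRel n
  E⁺ x y = E x y ∨ sameEdge u v x y

  E⁺-symmetric : ∀ x y → E⁺ x y ≡ E⁺ y x
  E⁺-symmetric x y rewrite E-sym x y | sameEdge-swap′ u v x y = refl

  E⁺-sym : ∀ {a b} → E⁺ a b ≡ true → E⁺ b a ≡ true
  E⁺-sym {a} {b} e = trans (E⁺-symmetric b a) e

  E⁺-irrefl : ∀ x → E⁺ x x ≡ false
  E⁺-irrefl x rewrite E-irrefl x = sameEdge-loop u≢v x

  E⁺-neighbour : ∀ {w} → E⁺ u w ≡ true → w ≢ v → E u w ≡ true
  E⁺-neighbour {w} e w≢v with ∨-true {E u w} e
  ... | inj₁ Euw = Euw
  ... | inj₂ s with sameEdge-true {a = u} {v} {u} {w} s
  ...   | inj₁ (_ , v≡w) = ⊥-elim (w≢v (sym v≡w))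
  ...   | inj₂ (_ , v≡u) = ⊥-elim (u≢v (sym v≡u))

  Adj⁺ : Fin n → Fin n → Set
  Adj⁺ a b = E⁺ a b ≡ true

  AllPaths : List (List (Fin n)) → Set
  AllPaths D = ∀ p → p ∈ D → IsPath E⁺ p

  traversed-path : ∀ {D R} → AllPaths D → Traverses D R → IsPath E⁺ R
  traversed-path ps (M , M∈D , o) = IsPath-oriented E⁺-sym (ps M M∈D) o

  paths-replace : ∀ L₁ R₀ R L₂ → AllPaths (L₁ ++ R₀ ∷ L₂) → IsPath E⁺ R → AllPaths (L₁ ++ R ∷ L₂)
  paths-replace L₁ R₀ R L₂ ps ip p m with member-replace L₁ R₀ R L₂ m
  ... | inj₁ m′ = ps p m′
  ... | inj₂ refl = ip

  Arm : List (List (Fin n)) → Fin n → Fin n → Set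
  Arm D c a = Σ (List (Fin n)) λ R → Traverses D R ×
              Σ (List (Fin n)) λ X → Σ (List (Fin n)) λ Y → (R ≡ X ++ u ∷ c ∷ Y) ×
              Σ (List (Fin n)) λ W → (c ∷ Y ≡ W ++ [ a ])

  arm-unique : ∀ {D c a a′} → AllPaths D → mult D u c ≤ 1 → Arm D c a → Arm D c a′ → a ≡ a′
  arm-unique {D} {c} {a} {a′} ps le
    (R₁ , tr₁@(M₁ , m₁ , o₁) , X , Y , e₁ , W , w₁) (R₂ , tr₂@(M₂ , m₂ , o₂) , X′ , Y′ , e₂ , W′ , w₂) =
    same-end (Oriented-join o₁ (subst (Oriented R₂) (sym same-path) o₂))
    where
    through : ∀ {R M X Y} → R ≡ X ++ u ∷ c ∷ Y → Oriented R M → 1 ≤ occ u c M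
    through {X = X} {Y} e o = subst (1 ≤_) (trans (cong (occ u c) (sym e)) (occ-oriented u c o)) (occ-step u c X Y)
    same-path : M₁ ≡ M₂
    same-path = unique-positive (occ u c) m₁ m₂ (through e₁ o₁) (through e₂ o₂) le
    un₁ : Unique (X ++ u ∷ c ∷ Y)
    un₁ = subst Unique e₁ (IsPath.distinct (traversed-path ps tr₁))
    same-end : Oriented R₁ R₂ → a ≡ a′
    same-end (inj₁ refl) =
      let (_ , eY) = split-unique X (c ∷ Y) X′ (c ∷ Y′) (trans (sym e₁) e₂)
                       (proj₁ (unique-mid X (c ∷ Y) un₁))
                       (proj₁ (unique-mid X′ (c ∷ Y′) (subst Unique (trans (sym e₁) e₂) un₁)))
      in snoc-last c (trans (sym w₁) (trans eY w₂))
    same-end (inj₂ refl) =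
      let eq : X ++ u ∷ c ∷ Y ≡ reverse (c ∷ Y′) ++ u ∷ reverse X′
          eq = trans (sym e₁) (trans (cong reverse e₂) (reverse-mid X′ u (c ∷ Y′)))
          (eX , _) = split-unique X (c ∷ Y) (reverse (c ∷ Y′)) (reverse X′) eq
                       (proj₁ (unique-mid X (c ∷ Y) un₁))
                       (proj₁ (unique-mid (reverse (c ∷ Y′)) (reverse X′) (subst Unique eq un₁)))
          c∈X : c ∈ X
          c∈X = subst (c ∈_) (sym (trans eX (unfold-reverse c Y′))) (∈-++⁺ʳ (reverse Y′) (here refl))
      in ⊥-elim (unique-after X Y un₁ c∈X)

  -- D decomposes E⁺ except for the
  -- edge uz, whose missing end z is counted as a "floating" end; the trail
  -- z ∷ S of floating ends visited so far (back to v) has no repetitions, and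
  -- each floating end is the end of the arm through its predecessor.
  record Partial (D : List (List (Fin n))) (z : Fin n) (S : List (Fin n)) : Set where
    field
      paths        : AllPaths D
      covers       : ∀ x y → E⁺ x y ≡ true → mult D x y + ι (sameEdge u z x y) ≡ 1
      uz-edge      : E⁺ u z ≡ true
      ends         : ∀ w → endCount D w + δ v w ≡ endCount D₀ w + δ z w
      size         : length D ≡ length D₀
      trail-unique : Unique (z ∷ S)
      trail-arms   : Linked (λ a c → Arm D c a) (z ∷ S)
      trail-last   : lastOr z S ≡ v

  previous : Fin n → List (Fin n) → Fin n
  previous z [] = z
  previous z (y ∷ _) = y

  Insertion : Set
  Insertion = Σ (List (List (Fin n))) λ D → IsPathDecomposition E⁺ D × length D ≡ length D₀ ×
                (∀ w → endCount D w + δ v w ≡ endCount D₀ w + δ u w)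

  module _ {D : List (List (Fin n))} {z : Fin n} {S : List (Fin n)} (st : Partial D z S) where
    open Partial st

    mult-≤1 : ∀ x y → mult D x y ≤ 1
    mult-≤1 x y with E⁺ x y in e
    ... | true = subst (mult D x y ≤_) (covers x y e) (m≤m+n _ _)
    ... | false = subst (_≤ 1) (sym (sum-zero (occ x y) D
                    λ p m → occ-nonedge E⁺ E⁺-symmetric (IsPath.walk (paths p m)) x y e)) z≤n

    mult-uz : mult D u z ≡ 0
    mult-uz = +-cancelʳ-≡ 1 (mult D u z) 0
      (subst (λ t → mult D u z + ι t ≡ 1) (sameEdge-refl u z) (covers u z uz-edge))

    u≢z : u ≢ z
    u≢z refl with trans (sym uz-edge) (E⁺-irrefl u)
    ... | ()

    ends-off-v : ∀ w → w ≢ v → endCount D w ≡ endCount D₀ w + δ z w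
    ends-off-v w w≢v = trans (sym (+-identityʳ _)) (trans (cong (endCount D w +_) (sym (δ-ne w≢v))) (ends w))

    z-end : 1 ≤ endCount D z
    z-end with z ≟ v
    ... | yes refl = subst (1 ≤_) (sym (+-cancelʳ-≡ (δ v v) _ _ (ends v))) v-end
    ... | no z≢v = subst (1 ≤_) (sym (trans (ends-off-v z z≢v) (cong (endCount D₀ z +_) (δ-self z))))
                     (m≤n+m 1 _)

  end-available : ∀ {D z S} → Partial D z S → mult D u (previous z S) < endCount D z
  end-available {D} {z} {[]} st = subst (_< endCount D z) (sym (mult-uz st)) (z-end st)
  end-available {D} {z} {y ∷ S′} st = ≤-trans (s≤s (mult-≤1 st u y)) two-ends
    where
    open Partial st
    z≢v : z ≢ v
    z≢v e = Unique[x∷xs]⇒x∉xs trail-unique (subst (_∈ (y ∷ S′)) (trans trail-last (sym e)) (lastOr-∈ y S′))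
    two-ends : 2 ≤ endCount D z
    two-ends = subst (2 ≤_)
      (sym (trans (ends-off-v st z z≢v) (trans (cong (endCount D₀ z +_) (δ-self z)) (+-comm _ 1))))
      (s≤s (u-nbrs-end z (E⁺-neighbour uz-edge z≢v)))


  ends-replace : ∀ L₁ R₀ R* L₂ a b → (∀ w → ι (isEnd w R₀) + δ b w ≡ ι (isEnd w R*) + δ a w) →
                 (∀ w → endCount (L₁ ++ R₀ ∷ L₂) w + δ v w ≡ endCount D₀ w + δ a w) →
                 ∀ w → endCount (L₁ ++ R* ∷ L₂) w + δ v w ≡ endCount D₀ w + δ b w
  ends-replace L₁ R₀ R* L₂ a b local ends w =
    combine _ _ _ (δ a w) (δ b w) (δ v w)
      (replace-sum (λ p → ι (isEnd w p)) L₁ R₀ R* L₂ (δ b w) (δ a w) (local w)) (ends w)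

  -- Final move: the path R ending at z avoids u, so R followed by u covers uz.
  finish : ∀ {z S} L₁ R₀ L₂ → Partial (L₁ ++ R₀ ∷ L₂) z S →
           ∀ R → Oriented R₀ R → ∀ X → R ≡ X ++ [ z ] → u ∉ R → Insertion
  finish {z} L₁ R₀ L₂ st R o X eR u∉R =
    L₁ ++ R⁺ ∷ L₂ ,
    record { paths = paths-replace L₁ R₀ R⁺ L₂ paths extended ; exact = exact } ,
    trans (sym (length-replace L₁ R₀ R⁺ L₂)) size ,
    ends-replace L₁ R₀ R⁺ L₂ z u ends-local ends
    where
    open Partial st
    R⁺ : List (Fin n)
    R⁺ = R ++ [ u ]
    R⁺-shape : R⁺ ≡ X ++ z ∷ [ u ]
    R⁺-shape = trans (cong (_++ [ u ]) eR) (++-assoc X [ z ] [ u ])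
    path-R : IsPath E⁺ R
    path-R = traversed-path paths (R₀ , ∈-insert L₁ , Oriented-sym o)
    extended : IsPath E⁺ R⁺
    extended = record
      { nontrivial = subst (2 ≤_) (sym (length-++ R)) (≤-trans (IsPath.nontrivial path-R) (m≤m+n _ 1))
      ; distinct = unique-snoc R u∉R (IsPath.distinct path-R)
      ; walk = subst (Linked Adj⁺) (sym R⁺-shape)
                 (linked-join X z [ u ] (subst (Linked Adj⁺) eR (IsPath.walk path-R)) (E⁺-sym uz-edge ∷ [-])) }
    occ-local : ∀ x y → occ x y R₀ + ι (sameEdge u z x y) ≡ occ x y R⁺ + 0
    occ-local x y = begin
        occ x y R₀ + ι (sameEdge u z x y)               ≡⟨ cong₂ _+_ (trans (occ-oriented x y o) (cong (occ x y) eR))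
                                                                     (cong ι (sameEdge-swap u z x y)) ⟩
        occ x y (X ++ [ z ]) + ι (sameEdge z u x y)     ≡⟨ cong (occ x y (X ++ [ z ]) +_) (sym (+-identityʳ _)) ⟩
        occ x y (X ++ [ z ]) + (ι (sameEdge z u x y) + 0) ≡⟨ sym (occ-split x y X z [ u ]) ⟩
        occ x y (X ++ z ∷ [ u ])                        ≡⟨ cong (occ x y) (sym R⁺-shape) ⟩
        occ x y R⁺                                      ≡⟨ sym (+-identityʳ _) ⟩
        occ x y R⁺ + 0                                  ∎
      where open ≡-Reasoning
    exact : ∀ x y → E⁺ x y ≡ true → mult (L₁ ++ R⁺ ∷ L₂) x y ≡ 1
    exact x y h = trans (sym (+-identityʳ _))
      (trans (sym (replace-sum (occ x y) L₁ R₀ R⁺ L₂ _ 0 (occ-local x y))) (covers x y h))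
    ends-local : ∀ w → ι (isEnd w R₀) + δ u w ≡ ι (isEnd w R⁺) + δ z w
    ends-local w = begin
        ι (isEnd w R₀) + δ u w                     ≡⟨ cong (λ t → ι t + δ u w) (trans (isEnd-oriented w o) (cong (isEnd w) eR)) ⟩
        ι (isEnd w (X ++ [ z ])) + δ u w           ≡⟨ cong (_+ δ u w) (isEnd-snoc w X z (subst Unique eR (IsPath.distinct path-R))
                                                          (subst (λ t → 2 ≤ length t) eR (IsPath.nontrivial path-R))) ⟩
        ι (startsAt w (X ++ [ z ])) + δ z w + δ u w ≡⟨ swap₃ _ (δ z w) (δ u w) ⟩
        ι (startsAt w (X ++ [ z ])) + δ u w + δ z w ≡⟨ cong (λ t → ι t + δ u w + δ z w) (trans (startsAt-mid w X z [] [ u ]) (cong (startsAt w) (sym R⁺-shape))) ⟩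
        ι (startsAt w R⁺) + δ u w + δ z w          ≡⟨ cong (_+ δ z w) (sym (isEnd-snoc w R u (IsPath.distinct extended)
                                                                                     (IsPath.nontrivial extended))) ⟩
        ι (isEnd w R⁺) + δ z w                     ∎
      where open ≡-Reasoning

  -- The new
  -- floating end is b, and it is the end of the arm through z.
  module Reroute {z S} L₁ R₀ L₂ (st : Partial (L₁ ++ R₀ ∷ L₂) z S) R (o : Oriented R₀ R)
                 C b A₁ A₀ (eC : R ≡ C ++ u ∷ b ∷ A₁) (eb : b ∷ A₁ ≡ A₀ ++ [ z ]) where
    open Partial st

    D : List (List (Fin n))
    D = L₁ ++ R₀ ∷ L₂

    R* : List (Fin n)
    R* = C ++ u ∷ reverse (b ∷ A₁)

    D* : List (List (Fin n))
    D* = L₁ ++ R* ∷ L₂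

    tail-reversed : reverse (b ∷ A₁) ≡ z ∷ reverse A₀
    tail-reversed = trans (cong reverse eb) (reverse-snoc A₀ z)

    R*-shape : R* ≡ C ++ u ∷ z ∷ reverse A₀
    R*-shape = cong (λ t → C ++ u ∷ t) tail-reversed

    R-ends-at-z : R ≡ (C ++ u ∷ A₀) ++ [ z ]
    R-ends-at-z = trans eC (trans (cong (λ t → C ++ u ∷ t) eb) (sym (++-assoc C (u ∷ A₀) [ z ])))

    path-R : IsPath E⁺ R
    path-R = traversed-path paths (R₀ , ∈-insert L₁ , Oriented-sym o)

    unique-R : Unique (C ++ u ∷ b ∷ A₁)
    unique-R = subst Unique eC (IsPath.distinct path-R)

    walk-split : Linked Adj⁺ (C ++ [ u ]) × Linked Adj⁺ (u ∷ b ∷ A₁)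
    walk-split = linked-split C u (b ∷ A₁) (subst (Linked Adj⁺) eC (IsPath.walk path-R))

    ub-edge : E⁺ u b ≡ true
    ub-edge = Linked.head (proj₂ walk-split)

    rerouted : IsPath E⁺ R*
    rerouted = record
      { nontrivial = subst (λ t → 2 ≤ length t) (sym R*-shape) (length≥2 C u z (reverse A₀))
      ; distinct = unique-flip C u (b ∷ A₁) unique-R
      ; walk = subst (Linked Adj⁺) (sym R*-shape)
          (linked-join C u (z ∷ reverse A₀) (proj₁ walk-split)
            (uz-edge ∷ subst (Linked Adj⁺) tail-reversed
                         (linked-reverse E⁺-sym (b ∷ A₁) (Linked.tail (proj₂ walk-split))))) }

    occ-local : ∀ x y → occ x y R₀ + ι (sameEdge u z x y) ≡ occ x y R* + ι (sameEdge u b x y)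
    occ-local x y = begin
        occ x y R₀ + ι (sameEdge u z x y)   ≡⟨ cong (_+ ι (sameEdge u z x y)) occ-R ⟩
        (K + (ι (sameEdge u b x y) + O)) + ι (sameEdge u z x y)
                                            ≡⟨ swapInner K _ _ O ⟩
        (K + (ι (sameEdge u z x y) + O)) + ι (sameEdge u b x y)
                                            ≡⟨ cong (_+ ι (sameEdge u b x y)) (sym occ-R*) ⟩
        occ x y R* + ι (sameEdge u b x y)   ∎
      where
      open ≡-Reasoning
      K = occ x y (C ++ [ u ])
      O = occ x y (b ∷ A₁)
      occ-R : occ x y R₀ ≡ K + (ι (sameEdge u b x y) + O)
      occ-R = trans (occ-oriented x y o) (trans (cong (occ x y) eC) (occ-split x y C u (b ∷ A₁)))
      occ-R* : occ x y R* ≡ K + (ι (sameEdge u z x y) + O)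
      occ-R* = trans (occ-split x y C u (reverse (b ∷ A₁)))
        (cong (K +_) (trans (cong (λ t → occ x y (u ∷ t)) tail-reversed)
          (cong (ι (sameEdge u z x y) +_) (trans (cong (occ x y) (sym tail-reversed)) (occ-reverse x y (b ∷ A₁))))))

    ends-local : ∀ w → ι (isEnd w R₀) + δ b w ≡ ι (isEnd w R*) + δ z w
    ends-local w = begin
        ι (isEnd w R₀) + δ b w                        ≡⟨ cong (λ t → ι t + δ b w) (trans (isEnd-oriented w o) (cong (isEnd w) R-ends-at-z)) ⟩
        ι (isEnd w (X ++ [ z ])) + δ b w              ≡⟨ cong (_+ δ b w) (isEnd-snoc w X z (subst Unique R-ends-at-z (IsPath.distinct path-R))
                                                             (subst (λ t → 2 ≤ length t) R-ends-at-z (IsPath.nontrivial path-R))) ⟩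
        ι (startsAt w (X ++ [ z ])) + δ z w + δ b w   ≡⟨ swap₃ _ (δ z w) (δ b w) ⟩
        ι (startsAt w (X ++ [ z ])) + δ b w + δ z w   ≡⟨ cong (_+ δ z w) (cong₂ (λ s t → ι s + ι t) same-start (sym reversed-start)) ⟩
        ι (startsAt w R*) + ι (startsAt w (reverse R*)) + δ z w
                                                      ≡⟨ cong (_+ δ z w) (sym (isEnd-split w R* (IsPath.distinct rerouted) (IsPath.nontrivial rerouted))) ⟩
        ι (isEnd w R*) + δ z w                        ∎
      where
      open ≡-Reasoning
      X = C ++ u ∷ A₀
      same-start : startsAt w (X ++ [ z ]) ≡ startsAt w R*
      same-start = trans (cong (startsAt w) (++-assoc C (u ∷ A₀) [ z ])) (startsAt-mid w C u (A₀ ++ [ z ]) (reverse (b ∷ A₁)))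
      reversed-start : startsAt w (reverse R*) ≡ ⌊ w ≟ b ⌋
      reversed-start = cong (startsAt w)
        (trans (reverse-mid C u (reverse (b ∷ A₁))) (cong (_++ u ∷ reverse C) (reverse-involutive (b ∷ A₁))))

    new-arm : Arm D* z b
    new-arm = R* , (R* , ∈-insert L₁ , inj₁ refl) , C , reverse A₀ , R*-shape , reverse A₁ ,
              trans (sym tail-reversed) (unfold-reverse b A₁)

    -- Arms through vertices other than b survive: only R₀ changed, and the
    -- part of R₀ on the far side of u from b is untouched.
    arm-kept : ∀ {a c} → b ≢ c → Arm D c a → Arm D* c a
    arm-kept {a} {c} b≢c (R₁ , (M₁ , m₁ , o₁) , X₁ , Y₁ , e₁ , W , w₁)
      with member-replace L₁ R* R₀ L₂ m₁
    ... | inj₁ m₁′ = R₁ , (M₁ , m₁′ , o₁) , X₁ , Y₁ , e₁ , W , w₁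
    ... | inj₂ refl = kept (Oriented-join o₁ (Oriented-sym o))
      where
      unique-R₁ : Unique (X₁ ++ u ∷ c ∷ Y₁)
      unique-R₁ = subst Unique e₁ (traversed-path paths (R₀ , ∈-insert L₁ , o₁) .IsPath.distinct)
      u∉X₁ : u ∉ X₁
      u∉X₁ = proj₁ (unique-mid X₁ (c ∷ Y₁) unique-R₁)
      kept : Oriented R₁ R → Arm D* c a
      kept (inj₁ refl) =
        let (_ , eY) = split-unique X₁ (c ∷ Y₁) C (b ∷ A₁) (trans (sym e₁) eC) u∉X₁
                         (proj₁ (unique-mid C (b ∷ A₁) unique-R))
        in ⊥-elim (b≢c (sym (proj₁ (∷-injective eY))))
      kept (inj₂ refl) =
        let eq : X₁ ++ u ∷ c ∷ Y₁ ≡ reverse (b ∷ A₁) ++ u ∷ reverse C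
            eq = trans (sym e₁) (trans (cong reverse eC) (reverse-mid C u (b ∷ A₁)))
            (_ , eY) = split-unique X₁ (c ∷ Y₁) (reverse (b ∷ A₁)) (reverse C) eq u∉X₁
                         (proj₁ (unique-mid (reverse (b ∷ A₁)) (reverse C) (subst Unique eq unique-R₁)))
            R₁′ = (b ∷ A₁) ++ u ∷ c ∷ Y₁
            reversed : reverse R₁′ ≡ R*
            reversed = trans (reverse-mid (b ∷ A₁) u (c ∷ Y₁))
                         (cong (_++ u ∷ reverse (b ∷ A₁)) (trans (cong reverse eY) (reverse-involutive C)))
        in R₁′ , (R* , ∈-insert L₁ , inj₂ (trans (sym (reverse-involutive R₁′)) (cong reverse reversed))) ,
           b ∷ A₁ , Y₁ , refl , W , w₁

    partial : b ∉ (z ∷ S) → Partial D* b (z ∷ S)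
    partial b∉ = record
      { paths = paths-replace L₁ R₀ R* L₂ paths rerouted
      ; covers = λ x y h → trans (sym (replace-sum (occ x y) L₁ R₀ R* L₂ _ _ (occ-local x y))) (covers x y h)
      ; uz-edge = ub-edge
      ; ends = ends-replace L₁ R₀ R* L₂ z b ends-local ends
      ; size = trans (sym (length-replace L₁ R₀ R* L₂)) size
      ; trail-unique = AllPairs._∷_ (¬Any⇒All¬ (z ∷ S) b∉) trail-unique
      ; trail-arms = new-arm ∷ linked-weaken z S trail-arms (¬Any⇒All¬ S (λ m → b∉ (there m))) arm-kept
      ; trail-last = trail-last }

  -- The end of the arm through z is a new vertex on the trail, unless it is z
  -- or the previous floating end: an earlier trail vertex is already the end
  -- of the arm through its successor, and arms are unique.
  fresh : ∀ {D z S} → Partial D z S → ∀ b → b ≢ z → b ≢ previous z S → Arm D b z → b ∉ (z ∷ S)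
  fresh st b b≢z b≢prev arm (here e) = b≢z e
  fresh {S = []} st b b≢z b≢prev arm (there ())
  fresh {S = y ∷ S′} st b b≢z b≢prev arm (there (here e)) = b≢prev e
  fresh {S = y ∷ S′} st b b≢z b≢prev arm (there (there m))
    with linked-pred y S′ (Linked.tail (Partial.trail-arms st)) m
  ... | p , p∈ , arm′ = Unique[x∷xs]⇒x∉xs (Partial.trail-unique st)
        (subst (_∈ (y ∷ S′)) (arm-unique (Partial.paths st) (mult-≤1 st u b) arm′ arm) p∈)

  Continue : List (List (Fin n)) → Fin n → List (Fin n) → Set
  Continue D z S = Σ (List (List (Fin n))) λ D* → Σ (Fin n) λ b → Partial D* b (z ∷ S) × b ∉ (z ∷ S)

  open import Data.List.Membership.DecPropositional (_≟_ {n}) using (_∈?_)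

  move : ∀ {z S} L₁ R₀ L₂ → Partial (L₁ ++ R₀ ∷ L₂) z S → isEnd z R₀ ≡ true →
         occ u (previous z S) R₀ ≡ 0 → Insertion ⊎ Continue (L₁ ++ R₀ ∷ L₂) z S
  move {z} {S} L₁ R₀ L₂ st end avoids with orient-to z R₀ end
  ... | R , o , X , eR with u ∈? R
  ...   | no u∉R = inj₁ (finish L₁ R₀ L₂ st R o X eR u∉R)
  ...   | yes u∈R with ∈-∃++ u∈R
  ...     | C , A , eCA with suffix-snoc C u A X z (trans (sym eCA) eR) (u≢z st)
  ...       | A₀ , eA with snoc-view A₀ z
  ...         | b , A₁ , eb = inj₂ (_ , b , Reroute.partial L₁ R₀ L₂ st R o C b A₁ A₀ eC (sym eb) b∉ , b∉)
    where
    eC : R ≡ C ++ u ∷ b ∷ A₁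
    eC = trans eCA (cong (λ t → C ++ u ∷ t) (trans eA eb))
    uses-ub : 1 ≤ occ u b R₀
    uses-ub = subst (1 ≤_) (trans (cong (occ u b) (sym eC)) (sym (occ-oriented u b o))) (occ-step u b C A₁)
    b≢z : b ≢ z
    b≢z refl = 1+n≰n (≤-trans (≤-trans uses-ub (member-≤ (occ u b) (∈-insert L₁))) (≤-reflexive (mult-uz st)))
    b≢prev : b ≢ previous z S
    b≢prev refl = 1+n≰n (≤-trans uses-ub (≤-reflexive avoids))
    b∉ : b ∉ (z ∷ S)
    b∉ = fresh st b b≢z b≢prev (R , (R₀ , ∈-insert L₁ , Oriented-sym o) , C , A₁ , eC , A₀ , sym eb)

  step : ∀ {D z S} → Partial D z S → Insertion ⊎ Continue D z S
  step {D} {z} {S} st with find-end-path z u (previous z S) D (end-available st)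
  ... | L₁ , R₀ , L₂ , refl , end , avoids = move L₁ R₀ L₂ st end avoids

  -- Each round puts a new vertex on the trail, so 'outside' bounds the rounds.
  run : ∀ fuel {D z S} → Partial D z S → outside (z ∷ S) < fuel → Insertion
  run (suc fuel) {z = z} {S} st lt with step st
  ... | inj₁ done = done
  ... | inj₂ (_ , b , st′ , b∉) = run fuel st′ (≤-trans (outside-cons b (z ∷ S) b∉) (≤-pred lt))

  start : Partial D₀ v []
  start = record
    { paths = λ p m → let ip = IsPathDecomposition.paths dec₀ p m in record
        { nontrivial = IsPath.nontrivial ip ; distinct = IsPath.distinct ip
        ; walk = Linked.map (λ {x} {y} e → cong (_∨ sameEdge u v x y) e) (IsPath.walk ip) }
    ; covers = covers₀
    ; uz-edge = trans (cong (E u v ∨_) (sameEdge-refl u v)) (∨-zeroʳ (E u v))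
    ; ends = λ w → refl
    ; size = refl
    ; trail-unique = AllPairs._∷_ All.[] AllPairs.[]
    ; trail-arms = [-]
    ; trail-last = refl }
    where
    covers₀ : ∀ x y → E⁺ x y ≡ true → mult D₀ x y + ι (sameEdge u v x y) ≡ 1
    covers₀ x y h with sameEdge u v x y in s
    ... | false = trans (+-identityʳ _) (IsPathDecomposition.exact dec₀ x y (trans (sym (∨-identityʳ (E x y))) h))
    ... | true = cong (_+ 1) (sum-zero (occ x y) D₀
                   λ p m → occ-nonedge E E-sym (IsPath.walk (IsPathDecomposition.paths dec₀ p m)) x y xy∉E)
      where
      xy∉E : E x y ≡ false
      xy∉E with sameEdge-true {a = u} {v} {x} {y} s
      ... | inj₁ (refl , refl) = uv∉E
      ... | inj₂ (refl , refl) = trans (E-sym v u) uv∉E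

  insertion : Insertion
  insertion = run (suc (outside (v ∷ []))) start ≤-refl

-- Because M is
-- induced, an edge of G ∖ M at u_i leads outside V(M), where earlier
-- insertions did not change end counts; so the hypotheses of the insertion
-- lemma hold at every stage.
module InsertMatching {n k} (G : Graph n) (u v : Fin k → Fin n) (IM : IsInducedMatching G u v)
  (D′ : List (List (Fin n))) (dec′ : IsPathDecomposition (delete G u v) D′)
  (no-passing : ∀ i w → ¬ ((delete G u v (u i) w ≡ true) × (endCount D′ w ≡ 0)))
  (v-ends : ∀ i → endCount D′ (v i) ≥ 1) where
  open IsInducedMatching IM

  matchEdge : Fin k → Fin n → Fin n → Bool
  matchEdge i x y = sameEdge (u i) (v i) x y

  partialG : List (Fin k) → EdgeRel n
  partialG is x y = delete G u v x y ∨ any (λ i → matchEdge i x y) is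

  partialG-sym : ∀ is x y → partialG is x y ≡ partialG is y x
  partialG-sym is x y
    rewrite Graph.sym G x y
          | any-cong (λ i → matchEdge i x y) (λ i → matchEdge i y x) (allFin k) (λ i → sameEdge-swap′ (u i) (v i) x y)
          | any-cong (λ i → matchEdge i x y) (λ i → matchEdge i y x) is (λ i → sameEdge-swap′ (u i) (v i) x y) = refl

  partialG-irrefl : ∀ is x → partialG is x x ≡ false
  partialG-irrefl is x rewrite Graph.irrefl G x = any-false (λ i → matchEdge i x x) is λ j _ → sameEdge-loop (u≢v j j) x

  partialG-all : ∀ x y → partialG (allFin k) x y ≡ adj G x y
  partialG-all x y with inM u v x y in inMxy
  ... | false rewrite ∧-identityʳ (adj G x y) = ∨-identityʳ (adj G x y)
  ... | true with any-witness (λ i → matchEdge i x y) (allFin k) inMxy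
  ...   | i , _ , s with sameEdge-true {a = u i} {v i} {x} {y} s
  ...     | inj₁ (refl , refl) rewrite edges i = refl
  ...     | inj₂ (refl , refl) rewrite Graph.sym G (v i) (u i) | edges i = refl

  hitsU hitsV : List (Fin k) → Fin n → ℕ
  hitsU is w = sum (map (λ i → δ (u i) w) is)
  hitsV is w = sum (map (λ i → δ (v i) w) is)

  hits-outside : ∀ is w → ¬ InVM u v w → hitsU is w ≡ 0 × hitsV is w ≡ 0
  hits-outside is w w∉ = sum-zero _ is (λ j _ → δ-ne λ e → w∉ (j , inj₁ e)) ,
                         sum-zero _ is (λ j _ → δ-ne λ e → w∉ (j , inj₂ e))

  Stage : List (Fin k) → Set
  Stage is = Σ (List (List (Fin n))) λ D → IsPathDecomposition (partialG is) D × length D ≡ length D′ ×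
               (∀ w → endCount D w + hitsV is w ≡ endCount D′ w + hitsU is w)

  balance-at : ∀ is ((D , _ , _ , ends) : Stage is) w {s t} → hitsV is w ≡ s → hitsU is w ≡ t →
               endCount D w + s ≡ endCount D′ w + t
  balance-at is (D , _ , _ , ends) w refl refl = ends w

  stage : ∀ is → Unique is → Stage is
  stage [] _ = D′ , decomposition-resp (λ x y → sym (∨-identityʳ (delete G u v x y))) dec′ , refl , λ w → refl
  stage (i ∷ is) un@(AllPairs._∷_ _ un′) with stage is un′
  ... | st@(D , dec , size , ends) =
    D* , decomposition-resp regroup dec* , trans size* size ,
    λ w → chain (endCount D* w) (endCount D w) (endCount D′ w) (δ (v i) w) (δ (u i) w) (hitsV is w) (hitsU is w)
                (ends* w) (ends w)
    where
    j≢i : ∀ {j} → j ∈ is → j ≢ i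
    j≢i m refl = Unique[x∷xs]⇒x∉xs un m
    uv-missing : partialG is (u i) (v i) ≡ false
    uv-missing
      rewrite any-true (λ j → matchEdge j (u i) (v i)) (allFin k) (∈-allFin i) (sameEdge-refl (u i) (v i))
            | ∧-zeroʳ (adj G (u i) (v i)) =
      any-false (λ j → matchEdge j (u i) (v i)) is λ j m → ¬-not λ s →
        [ (λ (p , _) → j≢i m (u-inj j i p)) , (λ (p , _) → u≢v j i p) ]′ (sameEdge-true {a = u j} {v j} {u i} {v i} s)
    v-end : 1 ≤ endCount D (v i)
    v-end = subst (1 ≤_) (sym (balance-00 (balance-at is st (v i)
              (sum-zero _ is λ j m → δ-ne λ e → j≢i m (v-inj j i (sym e)))
              (sum-zero _ is λ j _ → δ-ne λ e → u≢v j i (sym e))))) (v-ends i)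
    u-nbrs-end : ∀ w → partialG is (u i) w ≡ true → 1 ≤ endCount D w
    u-nbrs-end w e with ∨-true {delete G u v (u i) w} e
    ... | inj₁ e′ = subst (1 ≤_) (sym (balance-00 (balance-at is st w (proj₂ hits) (proj₁ hits))))
                      (n≢0⇒n>0 λ zero-ends → no-passing i w (e′ , zero-ends))
      where
      w∉ : ¬ InVM u v w
      w∉ w∈ = let (a , b) = ∧-true {adj G (u i) w} e′ in
        case trans (sym (not-injective b)) (induced (u i) w (i , inj₁ refl) w∈ a) of λ ()
      hits = hits-outside is w w∉
    ... | inj₂ e′ with any-witness (λ j → matchEdge j (u i) w) is e′
    ...   | j , m , s with sameEdge-true {a = u j} {v j} {u i} {w} s
    ...     | inj₁ (p , _) = ⊥-elim (j≢i m (u-inj j i p))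
    ...     | inj₂ (_ , q) = ⊥-elim (u≢v i j (sym q))
    open AddEdge (partialG is) (partialG-sym is) (partialG-irrefl is) (u i) (v i) (u≢v i i) uv-missing
                 D dec v-end u-nbrs-end
    D* = proj₁ insertion
    dec* = proj₁ (proj₂ insertion)
    size* = proj₁ (proj₂ (proj₂ insertion))
    ends* = proj₂ (proj₂ (proj₂ insertion))
    regroup : ∀ x y → E⁺ x y ≡ partialG (i ∷ is) x y
    regroup x y rewrite ∨-assoc (delete G u v x y) (any (λ j → matchEdge j x y) is) (matchEdge i x y) =
      cong (delete G u v x y ∨_) (∨-comm (any (λ j → matchEdge j x y) is) (matchEdge i x y))

  complete : Stage (allFin k)
  complete = stage (allFin k) (allFin⁺ k)

  hitsU-u : ∀ i → hitsU (allFin k) (u i) ≡ 1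
  hitsU-u i = count-injective u (allFin k) (allFin⁺ k) (∈-allFin i) (λ j e → u-inj j i e)

  hitsV-v : ∀ i → hitsV (allFin k) (v i) ≡ 1
  hitsV-v i = count-injective v (allFin k) (allFin⁺ k) (∈-allFin i) (λ j e → v-inj j i e)

  hitsV-u : ∀ i → hitsV (allFin k) (u i) ≡ 0
  hitsV-u i = sum-zero _ (allFin k) λ j _ → δ-ne λ e → u≢v i j e

  hitsU-v : ∀ i → hitsU (allFin k) (v i) ≡ 0
  hitsU-v i = sum-zero _ (allFin k) λ j _ → δ-ne λ e → u≢v j i (sym e)

lemma2p5 : ∀ {n k} (G : Graph n) (u v : Fin k → Fin n) →
    IsInducedMatching G u v →
    (D′ : List (List (Fin n))) →
    IsPathDecomposition (delete G u v) D′ →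
    (∀ i w → ¬ ((delete G u v (u i) w ≡ true) × (endCount D′ w ≡ 0))) →
    (∀ i → endCount D′ (v i) ≥ 1) →
    Σ (List (List (Fin n))) (λ D →
      IsPathDecomposition (adj G) D ×
      length D ≡ length D′ ×
      (∀ i → endCount D (u i) ≡ suc (endCount D′ (u i))) ×
      (∀ i → endCount D (v i) ≡ endCount D′ (v i) ∸ 1) ×
      (∀ w → ¬ InVM u v w → endCount D w ≡ endCount D′ w))
lemma2p5 {k = k} G u v IM D′ dec′ no-passing v-ends =
  let (D , dec , size , _) = complete in
  D , decomposition-resp partialG-all dec , size ,
  (λ i → balance-01 (balance-at (allFin k) complete (u i) (hitsV-u i) (hitsU-u i))) ,
  (λ i → balance-10 (balance-at (allFin k) complete (v i) (hitsV-v i) (hitsU-v i))) ,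
  (λ w w∉ → let (hu , hv) = hits-outside (allFin k) w w∉ in balance-00 (balance-at (allFin k) complete w hv hu))
  where open InsertMatching G u v IM D′ dec′ no-passing v-ends
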